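{- Let $n$ be an integer and $2\leq s\leq n-1$. There exists no perfect code $C$ of the hypercube $Q_n$ such that every vertex of $C$ has no circulation containing $1^s$ as a substring.
   Context: The hypercube $Q_n$ has as vertex set the binary strings of length $n$, two strings being adjacent if they differ in exactly one position. A perfect code of $Q_n$ is a set $C$ of vertices such that every vertex is at Hamming distance at most $1$ from exactly one vertex of $C$. For a binary string $b_1b_2\dots b_n$ and $1\le i\le n$, its $i$-th circulation is $b_ib_{i+1}\dots b_nb_1\dots b_{i-1}$. A string $f$ is a substring of $s$ if $s=xfy$ for some (possibly empty) strings $x,y$; $1^s$ denotes the string of $s$ ones. -}

module Defs where

open import Data.Bool using (Bool; true; false)
open import Data.Nat using (ℕ; zero; suc; _+_; _≤_; _<_)
open import Data.Fin using (Fin; toℕ)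
open import Data.List using (List; []; _∷_; _++_; drop; take; replicate)
open import Data.Vec using (Vec; toList)
open import Data.Product using (Σ; _×_; _,_; ∃)
open import Relation.Binary.PropositionalEquality using (_≡_)

Vertex : ℕ → Set
Vertex n = Vec Bool n

hamming : ∀ {n} → Vertex n → Vertex n → ℕ
hamming Data.Vec.[] Data.Vec.[] = 0
hamming (true Data.Vec.∷ xs) (true Data.Vec.∷ ys) = hamming xs ys
hamming (false Data.Vec.∷ xs) (false Data.Vec.∷ ys) = hamming xs ys
hamming (true Data.Vec.∷ xs) (false Data.Vec.∷ ys) = suc (hamming xs ys)
hamming (false Data.Vec.∷ xs) (true Data.Vec.∷ ys) = suc (hamming xs ys)

IsPerfectCode : (n : ℕ) → (Vertex n → Set) → Set
IsPerfectCode n C =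
  (v : Vertex n) →
    Σ (Vertex n) (λ c → C c × hamming v c ≤ 1 ×
      ((c' : Vertex n) → C c' → hamming v c' ≤ 1 → c' ≡ c))

-- the i-th circulation b_i ... b_n b_1 ... b_{i-1}, for i = k + 1 (k < n)
circulation : ∀ {n} → Vertex n → Fin n → List Bool
circulation v k = drop (toℕ k) (toList v) ++ take (toℕ k) (toList v)

IsSubstring : List Bool → List Bool → Set
IsSubstring f s = Σ (List Bool) (λ x → Σ (List Bool) (λ y → s ≡ x ++ f ++ y))

ones : ℕ → List Bool
ones s = replicate s true

module Submission where

-- Let 1ⁿ be the all-ones vertex of Q_n and let c be the codeword
-- covering it, so c is at Hamming distance at most 1 from 1ⁿ.  Either c = 1ⁿ,
-- whose (first) circulation contains 1^(n-1), or c has a single zero at some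
-- position a; rotating c so that this zero comes first gives 0 1^(n-1).  In
-- both cases some circulation of c contains 1^(n-1), hence 1^s for s ≤ n - 1,
-- so no perfect code avoids 1^s in all circulations of its codewords.

open import Defs
open import Data.Bool using (true; false)
open import Data.Nat using (ℕ; zero; suc; _+_; _∸_; _≤_; _<_; z≤n; s≤s; s≤s⁻¹)
open import Data.Nat.Properties using (+-comm; m+[n∸m]≡n; m+n≤o⇒n≤o; m<m+n; suc-injective)
open import Data.Fin using (Fin; toℕ; fromℕ<)
open import Data.Fin.Properties using (toℕ-fromℕ<)
import Data.Vec as Vec
open import Data.Vec using (toList)
open import Data.List using (List; []; _∷_; _++_; length; drop; take)
open import Data.List.Properties using (++-assoc; ++-identityʳ; length-replicate)
open import Data.Product using (Σ; _×_; _,_)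
open import Data.Sum using (_⊎_; inj₁; inj₂)
open import Relation.Nullary using (¬_)
open import Relation.Binary.PropositionalEquality using (_≡_; refl; sym; cong; cong₂; subst; module ≡-Reasoning)

ones-+ : ∀ a b → ones (a + b) ≡ ones a ++ ones b
ones-+ zero    b = refl
ones-+ (suc a) b = cong (true ∷_) (ones-+ a b)

ones-substring : ∀ {s m} → s ≤ m → IsSubstring (ones s) (ones m)
ones-substring {s} {m} s≤m = [] , ones (m ∸ s) , (begin
    ones m                  ≡⟨ cong ones (sym (m+[n∸m]≡n s≤m)) ⟩
    ones (s + (m ∸ s))      ≡⟨ ones-+ s (m ∸ s) ⟩
    ones s ++ ones (m ∸ s)  ∎)
  where open ≡-Reasoning

substring-trans : ∀ {f g h} → IsSubstring f g → IsSubstring g h → IsSubstring f h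
substring-trans {f} {g} {h} (x , y , g≡xfy) (u , v , h≡ugv) =
  u ++ x , y ++ v , (begin
    h                          ≡⟨ h≡ugv ⟩
    u ++ g ++ v                ≡⟨ cong (λ w → u ++ w ++ v) g≡xfy ⟩
    u ++ (x ++ f ++ y) ++ v    ≡⟨ cong (u ++_) (++-assoc x (f ++ y) v) ⟩
    u ++ x ++ (f ++ y) ++ v    ≡⟨ cong (λ w → u ++ x ++ w) (++-assoc f y v) ⟩
    u ++ x ++ f ++ y ++ v      ≡⟨ sym (++-assoc u x (f ++ y ++ v)) ⟩
    (u ++ x) ++ f ++ y ++ v    ∎)
  where open ≡-Reasoning

drop-length-++ : ∀ {A : Set} (p r : List A) → drop (length p) (p ++ r) ≡ r
drop-length-++ []      r = refl
drop-length-++ (_ ∷ p) r = drop-length-++ p r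

take-length-++ : ∀ {A : Set} (p r : List A) → take (length p) (p ++ r) ≡ p
take-length-++ []      []      = refl
take-length-++ []      (_ ∷ _) = refl
take-length-++ (x ∷ p) r       = cong (x ∷_) (take-length-++ p r)

rotate-past-prefix : ∀ {A : Set} (p r : List A) →
  drop (length p) (p ++ r) ++ take (length p) (p ++ r) ≡ r ++ p
rotate-past-prefix p r = cong₂ _++_ (drop-length-++ p r) (take-length-++ p r)

allOnes : ∀ n → Vertex n
allOnes n = Vec.replicate n true

at-distance-0-from-allOnes : ∀ {n} (c : Vertex n) →
  hamming (allOnes n) c ≤ 0 → toList c ≡ ones n
at-distance-0-from-allOnes Vec.[]          _ = refl
at-distance-0-from-allOnes (true Vec.∷ c)  h = cong (true ∷_) (at-distance-0-from-allOnes c h)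
at-distance-0-from-allOnes (false Vec.∷ c) ()

near-allOnes : ∀ {n} (c : Vertex n) → hamming (allOnes n) c ≤ 1 →
  (toList c ≡ ones n) ⊎
  Σ ℕ λ a → Σ ℕ λ b → (a + suc b ≡ n) × (toList c ≡ ones a ++ false ∷ ones b)
near-allOnes Vec.[] _ = inj₁ refl
near-allOnes (true Vec.∷ c) h with near-allOnes c h
... | inj₁ c≡1ⁿ = inj₁ (cong (true ∷_) c≡1ⁿ)
... | inj₂ (a , b , a+1+b≡n , c≡1ᵃ01ᵇ) =
  inj₂ (suc a , b , cong suc a+1+b≡n , cong (true ∷_) c≡1ᵃ01ᵇ)
near-allOnes {suc n} (false Vec.∷ c) (s≤s h) =
  inj₂ (0 , n , refl , cong (false ∷_) (at-distance-0-from-allOnes c h))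

circulation-single-zero : ∀ {n} (c : Vertex n) (a b : ℕ) (a<n : a < n) →
  toList c ≡ ones a ++ false ∷ ones b →
  circulation c (fromℕ< a<n) ≡ false ∷ ones (b + a)
circulation-single-zero c a b a<n c≡1ᵃ01ᵇ = begin
    drop (toℕ k) (toList c) ++ take (toℕ k) (toList c)
      ≡⟨ cong (λ i → drop i (toList c) ++ take i (toList c)) toℕk≡len ⟩
    drop (length (ones a)) (toList c) ++ take (length (ones a)) (toList c)
      ≡⟨ cong (λ w → drop (length (ones a)) w ++ take (length (ones a)) w) c≡1ᵃ01ᵇ ⟩
    drop (length (ones a)) (ones a ++ false ∷ ones b) ++ take (length (ones a)) (ones a ++ false ∷ ones b)
      ≡⟨ rotate-past-prefix (ones a) (false ∷ ones b) ⟩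
    false ∷ ones b ++ ones a
      ≡⟨ cong (false ∷_) (sym (ones-+ b a)) ⟩
    false ∷ ones (b + a) ∎
  where
    open ≡-Reasoning
    k = fromℕ< a<n
    toℕk≡len : toℕ k ≡ length (ones a)
    toℕk≡len = subst (toℕ k ≡_) (sym (length-replicate a)) (toℕ-fromℕ< a<n)

long-run-in-circulation : ∀ m (c : Vertex (suc m)) → hamming (allOnes (suc m)) c ≤ 1 →
  Σ (Fin (suc m)) λ k → IsSubstring (ones m) (circulation c k)
long-run-in-circulation m c h with near-allOnes c h
... | inj₁ c≡1ⁿ = Fin.zero , true ∷ [] , [] , cong (_++ []) c≡1ⁿ
... | inj₂ (a , b , a+1+b≡n , c≡1ᵃ01ᵇ) =
  fromℕ< a<n , false ∷ [] , [] , (begin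
    circulation c (fromℕ< a<n)   ≡⟨ circulation-single-zero c a b a<n c≡1ᵃ01ᵇ ⟩
    false ∷ ones (b + a)         ≡⟨ cong (λ i → false ∷ ones i) b+a≡m ⟩
    false ∷ ones m               ≡⟨ cong (false ∷_) (sym (++-identityʳ (ones m))) ⟩
    false ∷ ones m ++ []         ∎)
  where
    open ≡-Reasoning
    a<n : a < suc m
    a<n = subst (a <_) a+1+b≡n (m<m+n a (s≤s z≤n))
    b+a≡m : b + a ≡ m
    b+a≡m = suc-injective (begin
      suc (b + a)  ≡⟨ +-comm (suc b) a ⟩
      a + suc b    ≡⟨ a+1+b≡n ⟩
      suc m        ∎)

mainTheorem3 : (n s : ℕ) → 2 ≤ s → s + 1 ≤ n →
    (C : Vertex n → Set) → IsPerfectCode n C →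
    ¬ ((c : Vertex n) → C c → (k : Fin n) → ¬ IsSubstring (ones s) (circulation c k))
mainTheorem3 zero s _ s+1≤0 _ _ _ with m+n≤o⇒n≤o s s+1≤0
... | ()
mainTheorem3 (suc m) s _ s+1≤n C perfect avoids
  with perfect (allOnes (suc m))
... | c , c∈C , c-covers-1ⁿ , _
  with long-run-in-circulation m c c-covers-1ⁿ
... | k , 1ᵐ⊑circ = avoids c c∈C k (substring-trans (ones-substring s≤m) 1ᵐ⊑circ)
  where
    s≤m : s ≤ m
    s≤m = s≤s⁻¹ (subst (_≤ suc m) (+-comm s 1) s+1≤n)
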